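{- For every integer $N\ge 5$ there exists $q_0(N)$ such that for all prime powers $q\ge q_0(N)$, $$f^{\mathrm{opt}}(N,q)=u\big(f^{\mathrm{opt}}(\cdot,q),N,q,k^*(N)\big).$$
   Context: For $n\ge 1$, a function $\phi$ defined on $\{ -1,0,\dots,n-1\}$ with $\phi(-1)=0$, and an integer $-1\le k\le\frac{n-1}{2}$, set $u(\phi,n,q,k)=q^{2k+2}\phi(n-k-1)+\phi(k)+\sum_{i=0}^{k}q^i\sum_{j=k}^{n-2}q^j$. Define $f^{\mathrm{opt}}(n,q)$ by $f^{\mathrm{opt}}(-1,q)=f^{\mathrm{opt}}(0,q)=f^{\mathrm{opt}}(1,q)=0$, $f^{\mathrm{opt}}(2,q)=1$, $f^{\mathrm{opt}}(3,q)=q^2+1$, $f^{\mathrm{opt}}(4,q)=q^4+2q^2+q+1$, and recursively for $n\ge 5$: $f^{\mathrm{opt}}(n,q)=\min_{0\le k\le \frac{n-1}{2}}u(f^{\mathrm{opt}}(\cdot,q),n,q,k)$. For a positive integer $n$, $k^*(n)=n-2^{\lfloor\log_2 n\rfloor}$ is the unique integer $0\le k\le\frac{n-1}{2}$ such that $n-k$ is a power of two. -}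

module Defs where

open import Data.Nat using (ℕ; zero; suc; _+_; _*_; _∸_; _^_; _≤_; _⊓_; ⌊_/2⌋; _≡ᵇ_)
open import Data.Nat.Logarithm using (⌊log₂_⌋)
open import Data.Nat.Primality using (Prime)
open import Data.Bool using (if_then_else_)
open import Data.Product using (Σ; _×_; ∃-syntax)
open import Relation.Binary.PropositionalEquality using (_≡_)

-- sumFromTo a b g = Σ_{j=a}^{b} g j  (empty sum = 0 when b < a)
sumUpTo : ℕ → (ℕ → ℕ) → ℕ
sumUpTo zero    g = 0
sumUpTo (suc m) g = sumUpTo m g + g m

sumFromTo : ℕ → ℕ → (ℕ → ℕ) → ℕ
sumFromTo a b g = sumUpTo (suc b ∸ a) (λ t → g (a + t))

-- u(φ,n,q,k) = q^{2k+2} φ(n-k-1) + φ(k) + (Σ_{i=0}^{k} q^i)(Σ_{j=k}^{n-2} q^j)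
-- (only used with 0 ≤ k ≤ (n-1)/2, so all indices are natural numbers)
u : (ℕ → ℕ) → ℕ → ℕ → ℕ → ℕ
u φ n q k = q ^ (2 * k + 2) * φ (n ∸ k ∸ 1) + φ k
          + sumFromTo 0 k (λ i → q ^ i) * sumFromTo k (n ∸ 2) (λ j → q ^ j)

minUpTo : ℕ → (ℕ → ℕ) → ℕ
minUpTo zero    g = g 0
minUpTo (suc m) g = minUpTo m g ⊓ g (suc m)

-- one step of the recursion, given φ correct on {0,…,n-1}
foptStep : ℕ → ℕ → (ℕ → ℕ) → ℕ
foptStep q 0 φ = 0
foptStep q 1 φ = 0
foptStep q 2 φ = 1
foptStep q 3 φ = q ^ 2 + 1
foptStep q 4 φ = q ^ 4 + 2 * q ^ 2 + q + 1
foptStep q n@(suc (suc (suc (suc (suc _))))) φ =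
  minUpTo ⌊ (n ∸ 1) /2⌋ (λ k → u φ n q k)

-- table q n m = f^opt(m,q) for m < n
table : ℕ → ℕ → ℕ → ℕ
table q zero    m = 0
table q (suc n) m = if m ≡ᵇ n then foptStep q n (table q n) else table q n m

-- f^opt(n,q) for n ≥ 0 (f^opt(-1,q) = 0 is never needed for n ≥ 5)
fopt : ℕ → ℕ → ℕ
fopt n q = table q (suc n) n

kstar : ℕ → ℕ
kstar n = n ∸ 2 ^ ⌊log₂ n ⌋

IsPrimePower : ℕ → Set
IsPrimePower q = ∃[ p ] ∃[ e ] (Prime p × 1 ≤ e × q ≡ p ^ e)

{-# OPTIONS --safe #-}

-- Put p = q - 1, [j] = 1 + q + ⋯ + q^(j-1) and V j = q·p·f(j) + [j]. Then
-- q·p·u(f,n,q,k) + [n] = C(k, n-1-k) with C(k,m) = q^(2k+2)·V m + V k + q^k, so minimising u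
-- over k means minimising C along the antidiagonal k + m = n - 1. By strong induction on n,
-- together with f(n) = u(f,n,q,k*(n)), one shows V n ≤ q²·V(n-1) + 1, with slack p·q whenever
-- n is not a power of two. Given V k + 1 ≤ q^(2k), that slack gives C(k, m+1) ≤ C(k+1, m)
-- whenever m + 1 is not a power of two. Writing n = 2^s + r with r = k*(n), this holds on the
-- whole antidiagonal except at the step from k = r - 1 to k = r, where instead
-- C(r, 2^s - 1) ≤ C(0, n-1) = q²·V(n-1) + 1, because by induction V(n-1) = C(r-1, 2^s - 1).
-- So the minimum sits at k*(n), for every q ≥ 2.

module Submission where

open import Defs
open import Data.Nat
open import Data.Nat.Properties
open import Data.Nat.Logarithm using (⌊log₂_⌋; ⌊log₂⌋-mono-≤; ⌊log₂⌊n/2⌋⌋≡⌊log₂n⌋∸1; ⌊log₂[2^n]⌋≡n)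
open import Data.Nat.Induction using (<-rec)
open import Data.Nat.Tactic.RingSolver using (solve)
open import Data.List using (_∷_; [])
open import Data.Bool using (true; false)
open import Data.Product using (_×_; _,_; ∃₂; ∃-syntax)
open import Data.Sum using (inj₁; inj₂)
open import Relation.Nullary using (yes; no; contradiction)
open import Relation.Binary.PropositionalEquality
open ≤-Reasoning

minUpTo-≤ : ∀ {m k} (g : ℕ → ℕ) → k ≤ m → minUpTo m g ≤ g k
minUpTo-≤ {zero}  g z≤n = ≤-refl
minUpTo-≤ {suc m} g k≤1+m with m≤n⇒m<n∨m≡n k≤1+m
... | inj₁ k<1+m = ≤-trans (m⊓n≤m _ _) (minUpTo-≤ g (m<1+n⇒m≤n k<1+m))
... | inj₂ refl  = m⊓n≤n _ _

minUpTo-glb : ∀ {m b} (g : ℕ → ℕ) → (∀ {k} → k ≤ m → b ≤ g k) → b ≤ minUpTo m g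
minUpTo-glb {zero}  g b≤g = b≤g z≤n
minUpTo-glb {suc m} g b≤g = ⊓-glb (minUpTo-glb g (λ k≤m → b≤g (m≤n⇒m≤1+n k≤m))) (b≤g ≤-refl)

minUpTo-attained : ∀ {m j} (g : ℕ → ℕ) → j ≤ m → (∀ {k} → k ≤ m → g j ≤ g k) → minUpTo m g ≡ g j
minUpTo-attained g j≤m gj≤g = ≤-antisym (minUpTo-≤ g j≤m) (minUpTo-glb g gj≤g)

minUpTo-cong : ∀ {m} {g h : ℕ → ℕ} → (∀ {k} → k ≤ m → g k ≡ h k) → minUpTo m g ≡ minUpTo m h
minUpTo-cong {zero}  g≡h = g≡h z≤n
minUpTo-cong {suc m} g≡h = cong₂ _⊓_ (minUpTo-cong (λ k≤m → g≡h (m≤n⇒m≤1+n k≤m))) (g≡h ≤-refl)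

sumUpTo-+ : ∀ m n (g : ℕ → ℕ) → sumUpTo (m + n) g ≡ sumUpTo m g + sumUpTo n (λ t → g (m + t))
sumUpTo-+ m zero    g = trans (cong (λ i → sumUpTo i g) (+-identityʳ m)) (sym (+-identityʳ _))
sumUpTo-+ m (suc n) g rewrite +-suc m n | sumUpTo-+ m n g = +-assoc (sumUpTo m g) _ (g (m + n))

[j+[k+m]]∸k≡j+m : ∀ j k m → j + (k + m) ∸ k ≡ j + m
[j+[k+m]]∸k≡j+m j k m = trans (+-∸-assoc j (m≤m+n k m)) (cong (j +_) (m+n∸m≡n k m))

n∸k∸1<n : ∀ {n} k → 0 < n → n ∸ k ∸ 1 < n
n∸k∸1<n {suc n} k _ = s≤s (∸-monoˡ-≤ 1 (m∸n≤m (suc n) k))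

m+m<n+n⇒m<n : ∀ {m n} → m + m < n + n → m < n
m+m<n+n⇒m<n m+m<n+n = ≰⇒> (λ n≤m → <⇒≱ m+m<n+n (+-mono-≤ n≤m n≤m))

+≤⇒≤⌊/2⌋ : ∀ {k n} → k + k ≤ n → k ≤ ⌊ n /2⌋
+≤⇒≤⌊/2⌋ {k} k+k≤n = subst (_≤ _) (sym (n≡⌊n+n/2⌋ k)) (⌊n/2⌋-mono k+k≤n)

≤⌊/2⌋⇒+≤ : ∀ {k n} → k ≤ ⌊ n /2⌋ → k + k ≤ n
≤⌊/2⌋⇒+≤ {k} {n} k≤ = begin
  k + k             ≤⟨ +-mono-≤ k≤ (≤-trans k≤ (⌊n/2⌋≤⌈n/2⌉ n)) ⟩
  ⌊ n /2⌋ + ⌈ n /2⌉ ≡⟨ ⌊n/2⌋+⌈n/2⌉≡n n ⟩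
  n                 ∎

<+⇒⌊/2⌋< : ∀ {k n} → n < k + k → ⌊ n /2⌋ < k
<+⇒⌊/2⌋< n<k+k = ≰⇒> (λ k≤ → <⇒≱ n<k+k (≤⌊/2⌋⇒+≤ k≤))

0<n⇒⌊n/2⌋<n : ∀ {n} → 0 < n → ⌊ n /2⌋ < n
0<n⇒⌊n/2⌋<n {suc n} _ = ⌊n/2⌋<n n

2^[1+s]≡2^s+2^s : ∀ s → 2 ^ suc s ≡ 2 ^ s + 2 ^ s
2^[1+s]≡2^s+2^s s = cong (2 ^ s +_) (+-identityʳ (2 ^ s))

⌊log₂⌋-unique : ∀ s {n} → 2 ^ s ≤ n → n < 2 ^ suc s → ⌊log₂ n ⌋ ≡ s
⌊log₂⌋-unique zero    {suc zero}    _ _ = refl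
⌊log₂⌋-unique zero    {suc (suc n)} _ (s≤s (s≤s ()))
⌊log₂⌋-unique (suc s) {n} lo hi = ≤-antisym upper lower
  where
  lower : suc s ≤ ⌊log₂ n ⌋
  lower = subst (_≤ ⌊log₂ n ⌋) (⌊log₂[2^n]⌋≡n (suc s)) (⌊log₂⌋-mono-≤ lo)
  log-half : ⌊log₂ n ⌋ ∸ 1 ≡ s
  log-half = trans (sym (⌊log₂⌊n/2⌋⌋≡⌊log₂n⌋∸1 n))
    (⌊log₂⌋-unique s (+≤⇒≤⌊/2⌋ (subst (_≤ n) (2^[1+s]≡2^s+2^s s) lo))
                     (<+⇒⌊/2⌋< (subst (n <_) (2^[1+s]≡2^s+2^s (suc s)) hi)))
  upper : ⌊log₂ n ⌋ ≤ suc s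
  upper = subst (λ e → ⌊log₂ n ⌋ ≤ suc e) log-half (m≤n+m∸n ⌊log₂ n ⌋ 1)

r<2^s⇒2^s+r<2^[1+s] : ∀ s {r} → r < 2 ^ s → 2 ^ s + r < 2 ^ suc s
r<2^s⇒2^s+r<2^[1+s] s {r} r<2^s = subst (2 ^ s + r <_) (sym (2^[1+s]≡2^s+2^s s)) (+-monoʳ-< (2 ^ s) r<2^s)

kstar-+ : ∀ s {r} → r < 2 ^ s → kstar (2 ^ s + r) ≡ r
kstar-+ s {r} r<2^s
  rewrite ⌊log₂⌋-unique s (m≤m+n (2 ^ s) r) (r<2^s⇒2^s+r<2^[1+s] s r<2^s) = m+n∸m≡n (2 ^ s) r

kstar-pos : ∀ s {n} → 2 ^ s < n → n < 2 ^ suc s → 0 < kstar n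
kstar-pos s lo hi rewrite ⌊log₂⌋-unique s (<⇒≤ lo) hi = m<n⇒0<n∸m lo

kstar-pos-upperHalf : ∀ s {n} → 2 ^ s < n + n → n < 2 ^ s → 0 < kstar n
kstar-pos-upperHalf zero    {suc n} _ (s≤s ())
kstar-pos-upperHalf (suc s) {n} lo hi =
  kstar-pos s (m+m<n+n⇒m<n (subst (_< n + n) (2^[1+s]≡2^s+2^s s) lo)) hi

binary-decomposition : ∀ n → 0 < n → ∃₂ λ s r → r < 2 ^ s × 2 ^ s + r ≡ n
binary-decomposition (suc zero)    _ = 0 , 0 , z<s , refl
binary-decomposition (suc (suc n)) _ with binary-decomposition (suc n) z<s
... | s , r , r<2^s , 2^s+r≡1+n with m≤n⇒m<n∨m≡n r<2^s
...   | inj₁ 1+r<2^s = s , suc r , 1+r<2^s , trans (+-suc (2 ^ s) r) (cong suc 2^s+r≡1+n)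
...   | inj₂ 1+r≡2^s = suc s , 0 , m^n>0 2 (suc s) , (begin-equality
  2 ^ suc s + 0    ≡⟨ +-identityʳ _ ⟩
  2 ^ suc s        ≡⟨ 2^[1+s]≡2^s+2^s s ⟩
  2 ^ s + 2 ^ s    ≡⟨ cong (2 ^ s +_) 1+r≡2^s ⟨
  2 ^ s + suc r    ≡⟨ +-suc (2 ^ s) r ⟩
  suc (2 ^ s + r)  ≡⟨ cong suc 2^s+r≡1+n ⟩
  suc (suc n)      ∎)

table-lookup : ∀ q {m n} → m < n → table q n m ≡ fopt m q
table-lookup q {m} {suc n} m<1+n with m<1+n⇒m<n∨m≡n m<1+n
... | inj₂ refl = refl
... | inj₁ m<n with m ≡ᵇ n | ≡ᵇ⇒≡ m n
...   | false | _   = table-lookup q m<n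
...   | true  | m≡n = contradiction (m≡n _) (<⇒≢ m<n)

u-cong : ∀ {φ ψ} n q k → (∀ {i} → i < n → φ i ≡ ψ i) → k < n → u φ n q k ≡ u ψ n q k
u-cong n q k φ≡ψ k<n =
  cong₂ (λ x y → q ^ (2 * k + 2) * x + y + sumFromTo 0 k (q ^_) * sumFromTo k (n ∸ 2) (q ^_))
        (φ≡ψ (n∸k∸1<n k (≤-trans z<s k<n))) (φ≡ψ k<n)

fopt-recurrence : ∀ q n → 5 ≤ n → fopt n q ≡ minUpTo ⌊ pred n /2⌋ (u (λ m → fopt m q) n q)
fopt-recurrence q n@(suc n′@(suc (suc (suc (suc _))))) (s≤s (s≤s (s≤s (s≤s (s≤s _)))))
  with n ≡ᵇ n | ≡⇒≡ᵇ n n refl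
... | true | _ = minUpTo-cong (λ k≤h → u-cong n q _ (table-lookup q) (s≤s (≤-trans k≤h (⌊n/2⌋≤n n′))))

module Normalised (p : ℕ) (φ : ℕ → ℕ) where

  q : ℕ
  q = suc p

  geom : ℕ → ℕ
  geom j = sumUpTo j (q ^_)

  V : ℕ → ℕ
  V j = q * p * φ j + geom j

  cost : ℕ → ℕ → ℕ
  cost k m = q ^ (2 * k + 2) * V m + V k + q ^ k

  Growing : ℕ → Set
  Growing n = V n ≤ q * q * V (pred n) + 1

  GrowingStrictly : ℕ → Set
  GrowingStrictly n = V n + p * q ≤ q * q * V (pred n) + 1

  Bounded : ℕ → Set
  Bounded k = V k + 1 ≤ q ^ (2 * k)

  q^≡p*geom+1 : ∀ j → q ^ j ≡ p * geom j + 1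
  q^≡p*geom+1 zero    = cong (_+ 1) (sym (*-zeroʳ p))
  q^≡p*geom+1 (suc j) rewrite q^≡p*geom+1 j = expand (geom j)
    where
    expand : ∀ g → (1 + p) * (p * g + 1) ≡ p * (g + (p * g + 1)) + 1
    expand g = solve (p ∷ g ∷ [])

  geom-shift : ∀ k m → sumUpTo m (λ t → q ^ (k + t)) ≡ q ^ k * geom m
  geom-shift k zero    = sym (*-zeroʳ (q ^ k))
  geom-shift k (suc m) rewrite geom-shift k m | ^-distribˡ-+-* q k m =
    sym (*-distribˡ-+ (q ^ k) (geom m) (q ^ m))

  geom-+ : ∀ k m → geom (k + m) ≡ geom k + q ^ k * geom m
  geom-+ k m = trans (sumUpTo-+ k m (q ^_)) (cong (geom k +_) (geom-shift k m))

  q^[2+n]≡q*q*q^n : ∀ n → q ^ (2 + n) ≡ q * q * q ^ n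
  q^[2+n]≡q*q*q^n n = sym (*-assoc q q (q ^ n))

  q^[2k+2]≡q*q*q^[2k] : ∀ k → q ^ (2 * k + 2) ≡ q * q * q ^ (2 * k)
  q^[2k+2]≡q*q*q^[2k] k = trans (cong (q ^_) (+-comm (2 * k) 2)) (q^[2+n]≡q*q*q^n (2 * k))

  q^[2[1+k]+2]≡q*q*q^[2k+2] : ∀ k → q ^ (2 * suc k + 2) ≡ q * q * q ^ (2 * k + 2)
  q^[2[1+k]+2]≡q*q*q^[2k+2] k = trans (q^[2k+2]≡q*q*q^[2k] (suc k)) (cong (λ e → q * q * q ^ e) 2[1+k]≡2k+2)
    where
    2[1+k]≡2k+2 : 2 * suc k ≡ 2 * k + 2
    2[1+k]≡2k+2 = trans (*-suc 2 k) (+-comm 2 (2 * k))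

  q^[2k+2]≡q^[1+k]*q^[1+k] : ∀ k → q ^ (2 * k + 2) ≡ q ^ suc k * q ^ suc k
  q^[2k+2]≡q^[1+k]*q^[1+k] k = trans (cong (q ^_) (exponent k)) (^-distribˡ-+-* q (suc k) (suc k))
    where
    exponent : ∀ k → 2 * k + 2 ≡ suc k + suc k
    exponent k = solve (k ∷ [])

  u-expand : ∀ k m → u φ (2 + (k + m)) q k
                   ≡ q ^ (2 * k + 2) * φ (suc m) + φ k + geom (suc k) * (q ^ k * geom (suc m))
  u-expand k m = cong₂ (λ i s → q ^ (2 * k + 2) * φ (i ∸ 1) + φ k + geom (suc k) * s)
    ([j+[k+m]]∸k≡j+m 2 k m)
    (trans (cong (λ i → sumUpTo i (λ t → q ^ (k + t))) ([j+[k+m]]∸k≡j+m 1 k m)) (geom-shift k (suc m)))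

  -- The cross term [k+1]·q^k·[m] of u becomes q^(2k+2)·[m] because p·[k+1] + 1 = q^(k+1).
  u-normalised : ∀ {n k m} → suc (k + m) ≡ n → 0 < m → q * p * u φ n q k + geom n ≡ cost k m
  u-normalised {k = k} {m = suc m} refl _ rewrite +-suc k m = begin-equality
    q * p * u φ (2 + (k + m)) q k + geom (2 + (k + m))
      ≡⟨ cong₂ (λ x y → q * p * x + y) (u-expand k m) geom-split ⟩
    q * p * (q ^ (2 * k + 2) * φ (suc m) + φ k + geom (suc k) * (q ^ k * geom (suc m)))
      + (geom (suc k) + q ^ suc k * geom (suc m))
      ≡⟨ absorb (geom k) (geom (suc m)) (φ (suc m)) (φ k) (q^≡p*geom+1 k) (q^[2k+2]≡q^[1+k]*q^[1+k] k) ⟩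
    cost k (suc m) ∎
    where
    geom-split : geom (2 + (k + m)) ≡ geom (suc k) + q ^ suc k * geom (suc m)
    geom-split = trans (cong (λ i → geom (suc i)) (sym (+-suc k m))) (geom-+ (suc k) (suc m))
    absorb : ∀ g gm φm φk {x E} → x ≡ p * g + 1 → E ≡ (1 + p) * x * ((1 + p) * x) →
      (1 + p) * p * (E * φm + φk + (g + x) * (x * gm)) + (g + x + (1 + p) * x * gm)
      ≡ E * ((1 + p) * p * φm + gm) + ((1 + p) * p * φk + g) + x
    absorb g gm φm φk refl refl = solve (p ∷ g ∷ gm ∷ φm ∷ φk ∷ [])

  V≡cost : ∀ {n k m} → suc (k + m) ≡ n → 0 < m → φ n ≡ u φ n q k → V n ≡ cost k m
  V≡cost {n} n≡ 0<m φn≡u = trans (cong (λ x → q * p * x + geom n) φn≡u) (u-normalised n≡ 0<m)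

  V-zero : φ 0 ≡ 0 → V 0 ≡ 0
  V-zero φ0≡0 = trans (+-identityʳ _) (trans (cong (q * p *_) φ0≡0) (*-zeroʳ (q * p)))

  cost-zero : φ 0 ≡ 0 → ∀ m → cost 0 m ≡ q * q * V m + 1
  cost-zero φ0≡0 m rewrite φ0≡0 = shape (V m)
    where
    shape : ∀ v → (1 + p) * ((1 + p) * 1) * v + ((1 + p) * p * 0 + 0) + 1 ≡ (1 + p) * (1 + p) * v + 1
    shape v = solve (p ∷ v ∷ [])

  cost-succˡ : ∀ {k m} → Growing (suc k) → cost (suc k) m + p * q ^ suc k ≤ q * q * cost k m + 1
  cost-succˡ {k} {m} growing = begin
    cost (suc k) m + p * q ^ suc k
      ≡⟨ cong (λ E → E * V m + V (suc k) + q ^ suc k + p * q ^ suc k) (q^[2[1+k]+2]≡q*q*q^[2k+2] k) ⟩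
    q * q * q ^ (2 * k + 2) * V m + V (suc k) + q * q ^ k + p * (q * q ^ k)
      ≡⟨ regroup (q ^ (2 * k + 2)) (V m) (V (suc k)) (q ^ k) ⟩
    q * q * (q ^ (2 * k + 2) * V m + q ^ k) + V (suc k)
      ≤⟨ +-monoʳ-≤ (q * q * (q ^ (2 * k + 2) * V m + q ^ k)) growing ⟩
    q * q * (q ^ (2 * k + 2) * V m + q ^ k) + (q * q * V k + 1)
      ≡⟨ collect (q ^ (2 * k + 2)) (V m) (V k) (q ^ k) ⟩
    q * q * cost k m + 1 ∎
    where
    regroup : ∀ E v w x → (1 + p) * (1 + p) * E * v + w + (1 + p) * x + p * ((1 + p) * x)
                          ≡ (1 + p) * (1 + p) * (E * v + x) + w
    regroup E v w x = solve (p ∷ E ∷ v ∷ w ∷ x ∷ [])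
    collect : ∀ E v w x → (1 + p) * (1 + p) * (E * v + x) + ((1 + p) * (1 + p) * w + 1)
                          ≡ (1 + p) * (1 + p) * (E * v + w + x) + 1
    collect E v w x = solve (p ∷ E ∷ v ∷ w ∷ x ∷ [])

module Monotone (a : ℕ) (φ : ℕ → ℕ) where
  p : ℕ
  p = suc a

  open Normalised p φ

  Growing⇒Bounded : φ 0 ≡ 0 → ∀ k → (∀ {i} → i ≤ k → Growing i) → Bounded k
  Growing⇒Bounded φ0≡0 zero _ = ≤-reflexive (cong (_+ 1) (V-zero φ0≡0))
  Growing⇒Bounded φ0≡0 (suc k) growing = begin
    V (suc k) + 1         ≤⟨ +-monoˡ-≤ 1 (growing ≤-refl) ⟩
    q * q * V k + 1 + 1   ≤⟨ m≤m+n _ _ ⟩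
    q * q * V k + 1 + 1 + (2 + a * (4 + a)) ≡⟨ spread (V k) ⟩
    q * q * (V k + 1)     ≤⟨ *-monoʳ-≤ (q * q) (Growing⇒Bounded φ0≡0 k (λ i≤k → growing (m≤n⇒m≤1+n i≤k))) ⟩
    q * q * q ^ (2 * k)   ≡⟨ q^[2+n]≡q*q*q^n (2 * k) ⟨
    q ^ (2 + 2 * k)       ≡⟨ cong (q ^_) (*-suc 2 k) ⟨
    q ^ (2 * suc k)       ∎
    where
    spread : ∀ v → (2 + a) * (2 + a) * v + 1 + 1 + (2 + a * (4 + a)) ≡ (2 + a) * (2 + a) * (v + 1)
    spread v = solve (a ∷ v ∷ [])

  -- Multiplying the strict growth of W₁ by Q = q²E frees Q·pq, which pays for Q + w + x ≤ Q + 2E;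
  -- this is where q ≥ 2 is needed.
  step-inequality : ∀ {E W₁ W₀ w w′ x} → W₁ + p * q ≤ q * q * W₀ + 1 → w + 1 ≤ E → x ≤ E
                  → q * q * E * W₁ + w + x ≤ q * q * (q * q * E) * W₀ + w′ + q * x
  step-inequality {E} {W₁} {W₀} {w} {w′} {x} W₁-bound w+1≤E x≤E = +-cancelʳ-≤ (Q * (p * q)) _ _ (begin
    Q * W₁ + w + x + Q * (p * q)      ≡⟨ distrib E W₁ w x ⟩
    Q * (W₁ + p * q) + (w + x)        ≤⟨ +-mono-≤ (*-monoʳ-≤ Q W₁-bound) (+-mono-≤ (m+n≤o⇒m≤o w w+1≤E) x≤E) ⟩
    Q * (q * q * W₀ + 1) + (E + E)    ≡⟨ collect E W₀ ⟩
    q * q * Q * W₀ + (Q + (E + E))    ≤⟨ +-monoʳ-≤ (q * q * Q * W₀) (m≤m+n _ _) ⟩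
    q * q * Q * W₀ + (Q + (E + E) + (E * (2 + a * (4 + a)) + Q * (a * (3 + a))))
                                      ≡⟨ cong (q * q * Q * W₀ +_) (slack E) ⟨
    q * q * Q * W₀ + Q * (p * q)      ≤⟨ +-monoˡ-≤ (Q * (p * q)) (≤-trans (m≤m+n _ w′) (m≤m+n _ (q * x))) ⟩
    q * q * Q * W₀ + w′ + q * x + Q * (p * q) ∎)
    where
    Q = q * q * E
    distrib : ∀ E W w x → (2 + a) * (2 + a) * E * W + w + x + (2 + a) * (2 + a) * E * ((1 + a) * (2 + a))
                        ≡ (2 + a) * (2 + a) * E * (W + (1 + a) * (2 + a)) + (w + x)
    distrib E W w x = solve (a ∷ E ∷ W ∷ w ∷ x ∷ [])
    collect : ∀ E W → (2 + a) * (2 + a) * E * ((2 + a) * (2 + a) * W + 1) + (E + E)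
                    ≡ (2 + a) * (2 + a) * ((2 + a) * (2 + a) * E) * W + ((2 + a) * (2 + a) * E + (E + E))
    collect E W = solve (a ∷ E ∷ W ∷ [])
    slack : ∀ E → (2 + a) * (2 + a) * E * ((1 + a) * (2 + a))
                ≡ (2 + a) * (2 + a) * E + (E + E) + (E * (2 + a * (4 + a)) + (2 + a) * (2 + a) * E * (a * (3 + a)))
    slack E = solve (a ∷ E ∷ [])

  cost-step : ∀ {k m} → GrowingStrictly (suc m) → Bounded k → cost k (suc m) ≤ cost (suc k) m
  cost-step {k} {m} strictly bounded = begin
    cost k (suc m)
      ≡⟨ cong (λ E → E * V (suc m) + V k + q ^ k) (q^[2k+2]≡q*q*q^[2k] k) ⟩
    q * q * q ^ (2 * k) * V (suc m) + V k + q ^ k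
      ≤⟨ step-inequality strictly bounded (^-monoʳ-≤ q (m≤m+n k (k + 0))) ⟩
    q * q * (q * q * q ^ (2 * k)) * V m + V (suc k) + q * q ^ k
      ≡⟨ cong (λ E → E * V m + V (suc k) + q ^ suc k) q^[2[1+k]+2]≡q*q*q*q*q^[2k] ⟨
    cost (suc k) m ∎
    where
    q^[2[1+k]+2]≡q*q*q*q*q^[2k] : q ^ (2 * suc k + 2) ≡ q * q * (q * q * q ^ (2 * k))
    q^[2[1+k]+2]≡q*q*q*q*q^[2k] =
      trans (q^[2[1+k]+2]≡q*q*q^[2k+2] k) (cong (q * q *_) (q^[2k+2]≡q*q*q^[2k] k))

  cost-chain : ∀ d {k m} → (∀ {j} → j < d → GrowingStrictly (suc (j + m))) → (∀ {i} → i < d + k → Bounded i)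
             → cost k (d + m) ≤ cost (d + k) m
  cost-chain zero        _        _       = ≤-refl
  cost-chain (suc d) {k} {m} strictly bounded = begin
    cost k (suc d + m)   ≤⟨ cost-step (strictly ≤-refl) (bounded (s≤s (m≤n+m k d))) ⟩
    cost (suc k) (d + m) ≤⟨ cost-chain d (λ j<d → strictly (m<n⇒m<1+n j<d))
                                         (λ {i} i<d+1+k → bounded (subst (i <_) (+-suc d k) i<d+1+k)) ⟩
    cost (d + suc k) m   ≡⟨ cong (λ i → cost i m) (+-suc d k) ⟩
    cost (suc d + k) m   ∎

  cost-≤⇒u-≤ : ∀ {n k m k′ m′} → suc (k + m) ≡ n → 0 < m → suc (k′ + m′) ≡ n → 0 < m′
              → cost k m ≤ cost k′ m′ → u φ n q k ≤ u φ n q k′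
  cost-≤⇒u-≤ {n} n≡ 0<m n≡′ 0<m′ cost≤ = *-cancelˡ-≤ (q * p) (+-cancelʳ-≤ (geom n) _ _
    (subst₂ _≤_ (sym (u-normalised n≡ 0<m)) (sym (u-normalised n≡′ 0<m′)) cost≤))

module Optimality (a : ℕ) where

  F : ℕ → ℕ
  F j = fopt j (2 + a)

  open Normalised (suc a) F
  open Monotone a F

  record Invariant (n : ℕ) : Set where
    field
      recurrence       : 4 ≤ n → F n ≡ u F n q (kstar n)
      growing          : Growing n
      growing-strictly : 0 < kstar n → GrowingStrictly n

  open Invariant

  invariant-0 : Invariant 0
  invariant-0 = record
    { recurrence       = λ ()
    ; growing          = ≤-trans (m≤n*m (V 0) (q * q)) (m≤m+n _ 1)
    ; growing-strictly = λ ()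
    }

  invariant-1 : Invariant 1
  invariant-1 = record
    { recurrence       = λ { (s≤s ()) }
    ; growing          = ≤-trans (≤-reflexive (cong (_+ 1) (*-zeroʳ (q * p)))) (m≤n+m 1 _)
    ; growing-strictly = λ ()
    }

  invariant-2 : Invariant 2
  invariant-2 = record
    { recurrence       = λ { (s≤s (s≤s ())) }
    ; growing          = ≤-reflexive (trans (V≡cost {2} {0} {1} refl z<s F2≡u) (cost-zero refl 1))
    ; growing-strictly = λ ()
    }
    where
    F2≡u : F 2 ≡ u F 2 q 0
    F2≡u = sym (cong (λ x → x + 0 + 1) (*-zeroʳ (q ^ 2)))

  invariant-3 : Invariant 3
  invariant-3 = record
    { recurrence       = λ { (s≤s (s≤s (s≤s ()))) }
    ; growing          = ≤-trans (m≤m+n _ _) strictly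
    ; growing-strictly = λ _ → strictly
    }
    where
    V3+pq+pqp≡q²V2+1 : (2 + a) * (1 + a) * ((2 + a) * ((2 + a) * 1) + 1) + (1 + (2 + a) * 1 + (2 + a) * ((2 + a) * 1))
                       + (1 + a) * (2 + a) + (1 + a) * (2 + a) * (1 + a)
                     ≡ (2 + a) * (2 + a) * ((2 + a) * (1 + a) * 1 + (1 + (2 + a) * 1)) + 1
    V3+pq+pqp≡q²V2+1 = solve (a ∷ [])
    strictly : GrowingStrictly 3
    strictly = ≤-trans (m≤m+n _ (p * q * p)) (≤-reflexive V3+pq+pqp≡q²V2+1)

  invariant-4 : Invariant 4
  invariant-4 = record
    { recurrence       = λ _ → F4≡u
    ; growing          = ≤-reflexive (trans (V≡cost {4} {0} {3} refl z<s F4≡u) (cost-zero refl 3))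
    ; growing-strictly = λ ()
    }
    where
    F4≡u : (2 + a) * ((2 + a) * ((2 + a) * ((2 + a) * 1))) + 2 * ((2 + a) * ((2 + a) * 1)) + (2 + a) + 1
         ≡ (2 + a) * ((2 + a) * 1) * ((2 + a) * ((2 + a) * 1) + 1) + 0
           + 1 * (1 + (2 + a) * 1 + (2 + a) * ((2 + a) * 1))
    F4≡u = solve (a ∷ [])

  module Step {n′} (4≤n′ : 4 ≤ n′) (ih : ∀ {i} → i ≤ n′ → Invariant i)
              {s r} (r<2^s : r < 2 ^ s) (2^s+r≡1+n′ : 2 ^ s + r ≡ suc n′) where

    P′ : ℕ
    P′ = pred (2 ^ s)

    2^s≡1+P′ : 2 ^ s ≡ suc P′
    2^s≡1+P′ = sym (suc-pred (2 ^ s) {{m^n≢0 2 s}})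

    P′+r≡n′ : P′ + r ≡ n′
    P′+r≡n′ = suc-injective (trans (cong (_+ r) (sym 2^s≡1+P′)) 2^s+r≡1+n′)

    r≤P′ : r ≤ P′
    r≤P′ = m<1+n⇒m≤n (subst (r <_) 2^s≡1+P′ r<2^s)

    P′≤n′ : P′ ≤ n′
    P′≤n′ = subst (P′ ≤_) P′+r≡n′ (m≤m+n P′ r)

    r+r≤n′ : r + r ≤ n′
    r+r≤n′ = subst (r + r ≤_) P′+r≡n′ (+-monoˡ-≤ r r≤P′)

    0<P′ : 0 < P′
    0<P′ = m+m<n+n⇒m<n (≤-trans (s≤s z≤n) (≤-trans 4≤n′ (subst (_≤ P′ + P′) P′+r≡n′ (+-monoʳ-≤ P′ r≤P′))))

    n′<2^[1+s] : n′ < 2 ^ suc s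
    n′<2^[1+s] = <⇒≤ (subst (_< 2 ^ suc s) 2^s+r≡1+n′ (r<2^s⇒2^s+r<2^[1+s] s r<2^s))

    kstar-n : kstar (suc n′) ≡ r
    kstar-n = subst (λ x → kstar x ≡ r) 2^s+r≡1+n′ (kstar-+ s r<2^s)

    bounded : ∀ {i} → i ≤ n′ → Bounded i
    bounded {i} i≤n′ = Growing⇒Bounded refl i (λ j≤i → growing (ih (≤-trans j≤i i≤n′)))

    r+P′≡n′ : r + P′ ≡ n′
    r+P′≡n′ = trans (+-comm r P′) P′+r≡n′

    V-n′≡cost : ∀ {r′} → r ≡ suc r′ → V n′ ≡ cost r′ P′
    V-n′≡cost {r′} refl = V≡cost {n′} {r′} {P′} (trans (cong suc (+-comm r′ P′)) (trans (sym (+-suc P′ r′)) P′+r≡n′)) 0<P′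
      (subst (λ k → F n′ ≡ u F n′ q k) kstar-n′ (recurrence (ih ≤-refl) 4≤n′))
      where
      kstar-n′ : kstar n′ ≡ r′
      kstar-n′ = subst (λ x → kstar x ≡ r′) (suc-injective (trans (sym (+-suc (2 ^ s) r′)) 2^s+r≡1+n′))
                       (kstar-+ s (<⇒≤ r<2^s))

    -- n′ = 2^s + (r - 1), so by induction V n′ = cost (r - 1) P′.
    cost-r+pq^r≤cost-0 : ∀ {r′} → r ≡ suc r′ → cost r P′ + p * q ^ r ≤ cost 0 n′
    cost-r+pq^r≤cost-0 {r′} refl = begin
      cost (suc r′) P′ + p * q ^ suc r′ ≤⟨ cost-succˡ {r′} {P′} (growing (ih (≤-trans r≤P′ P′≤n′))) ⟩
      q * q * cost r′ P′ + 1            ≡⟨ cong (λ v → q * q * v + 1) (V-n′≡cost refl) ⟨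
      q * q * V n′ + 1                  ≡⟨ cost-zero refl n′ ⟨
      cost 0 n′                         ∎

    cost-r≤cost-0 : cost r P′ ≤ cost 0 n′
    cost-r≤cost-0 = by-cases r refl
      where
      by-cases : ∀ x → r ≡ x → cost r P′ ≤ cost 0 n′
      by-cases zero    refl = ≤-reflexive (cong (cost 0) (trans (sym (+-identityʳ P′)) P′+r≡n′))
      by-cases (suc _) r≡   = ≤-trans (m≤m+n _ _) (cost-r+pq^r≤cost-0 r≡)

    -- The values m + 1 met by cost-chain lie in (2^(s-1), 2^s) when starting from r and in
    -- (2^s, 2^(s+1)) when starting from 0; neither range contains a power of two.
    cost-r≤cost-above : ∀ {k m} → k + m ≡ n′ → k ≤ m → r ≤ k → cost r P′ ≤ cost k m
    cost-r≤cost-above {k} {m} k+m≡n′ k≤m r≤k = begin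
      cost r P′       ≡⟨ cong (cost r) P′≡d+m ⟩
      cost r (d + m)  ≤⟨ cost-chain d strictly (λ {i} i<d+r → bounded (≤-trans (<⇒≤ (subst (i <_) d+r≡k i<d+r)) k≤n′)) ⟩
      cost (d + r) m  ≡⟨ cong (λ i → cost i m) d+r≡k ⟩
      cost k m        ∎
      where
      d = k ∸ r
      d+r≡k : d + r ≡ k
      d+r≡k = m∸n+n≡m r≤k
      k≤n′ : k ≤ n′
      k≤n′ = subst (k ≤_) k+m≡n′ (m≤m+n k m)
      P′≡d+m : P′ ≡ d + m
      P′≡d+m = +-cancelʳ-≡ r P′ (d + m) (begin-equality
        P′ + r       ≡⟨ P′+r≡n′ ⟩
        n′           ≡⟨ k+m≡n′ ⟨
        k + m        ≡⟨ cong (_+ m) d+r≡k ⟨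
        d + r + m    ≡⟨ +-assoc d r m ⟩
        d + (r + m)  ≡⟨ cong (d +_) (+-comm r m) ⟩
        d + (m + r)  ≡⟨ +-assoc d m r ⟨
        d + m + r    ∎)
      strictly : ∀ {j} → j < d → GrowingStrictly (suc (j + m))
      strictly {j} j<d = growing-strictly (ih x≤n′) (kstar-pos-upperHalf s lower upper)
        where
        x≤P′ : suc (j + m) ≤ P′
        x≤P′ = subst (suc (j + m) ≤_) (sym P′≡d+m) (+-monoˡ-≤ m j<d)
        x≤n′ : suc (j + m) ≤ n′
        x≤n′ = ≤-trans x≤P′ P′≤n′
        upper : suc (j + m) < 2 ^ s
        upper = subst (suc (j + m) <_) (sym 2^s≡1+P′) (s≤s x≤P′)
        1+m≤x : suc m ≤ suc (j + m)
        1+m≤x = s≤s (m≤n+m m j)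
        lower : 2 ^ s < suc (j + m) + suc (j + m)
        lower = begin-strict
          2 ^ s              ≤⟨ m≤m+n (2 ^ s) r ⟩
          2 ^ s + r          ≡⟨ 2^s+r≡1+n′ ⟩
          suc n′             ≡⟨ cong suc k+m≡n′ ⟨
          suc (k + m)        ≤⟨ s≤s (+-monoˡ-≤ m k≤m) ⟩
          suc (m + m)        <⟨ s<s (+-monoʳ-< m (n<1+n m)) ⟩
          suc (m + suc m)    ≤⟨ +-mono-≤ 1+m≤x 1+m≤x ⟩
          suc (j + m) + suc (j + m) ∎

    cost-r≤cost-below : ∀ {k m} → k + m ≡ n′ → k < r → cost r P′ ≤ cost k m
    cost-r≤cost-below {k} {m} k+m≡n′ k<r = begin
      cost r P′       ≤⟨ cost-r≤cost-0 ⟩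
      cost 0 n′       ≡⟨ cong (cost 0) k+m≡n′ ⟨
      cost 0 (k + m)  ≤⟨ cost-chain k strictly (λ i<k+0 → bounded (≤-trans (<⇒≤ i<k+0) k+0≤n′)) ⟩
      cost (k + 0) m  ≡⟨ cong (λ i → cost i m) (+-identityʳ k) ⟩
      cost k m        ∎
      where
      k+0≤n′ : k + 0 ≤ n′
      k+0≤n′ = subst (_≤ n′) (sym (+-identityʳ k)) (subst (k ≤_) k+m≡n′ (m≤m+n k m))
      2^s≤m : 2 ^ s ≤ m
      2^s≤m = +-cancelʳ-≤ r (2 ^ s) m (begin
        2 ^ s + r    ≡⟨ 2^s+r≡1+n′ ⟩
        suc n′       ≡⟨ cong suc k+m≡n′ ⟨
        suc k + m    ≤⟨ +-monoˡ-≤ m k<r ⟩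
        r + m        ≡⟨ +-comm r m ⟩
        m + r        ∎)
      strictly : ∀ {j} → j < k → GrowingStrictly (suc (j + m))
      strictly {j} j<k = growing-strictly (ih x≤n′) (kstar-pos s (s≤s (≤-trans 2^s≤m (m≤n+m m j))) (≤-trans (s≤s x≤n′) n′<2^[1+s]))
        where
        x≤n′ : suc (j + m) ≤ n′
        x≤n′ = subst (suc (j + m) ≤_) k+m≡n′ (+-monoˡ-≤ m j<k)

    cost-minimal : ∀ {k m} → k + m ≡ n′ → k ≤ m → cost r P′ ≤ cost k m
    cost-minimal {k} k+m≡n′ k≤m with r ≤? k
    ... | yes r≤k = cost-r≤cost-above k+m≡n′ k≤m r≤k
    ... | no  r≰k = cost-r≤cost-below k+m≡n′ (≰⇒> r≰k)

    recurrence-n : F (suc n′) ≡ u F (suc n′) q r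
    recurrence-n = trans (fopt-recurrence q (suc n′) (s≤s 4≤n′))
                         (minUpTo-attained {j = r} (u F (suc n′) q) (+≤⇒≤⌊/2⌋ r+r≤n′) u-r≤u-k)
      where
      u-r≤u-k : ∀ {k} → k ≤ ⌊ n′ /2⌋ → u F (suc n′) q r ≤ u F (suc n′) q k
      u-r≤u-k {k} k≤h = cost-≤⇒u-≤ (cong suc r+P′≡n′) 0<P′ (cong suc k+m≡n′) (m<n⇒0<n∸m k<n′)
                                    (cost-minimal k+m≡n′ (m+n≤o⇒m≤o∸n k (≤⌊/2⌋⇒+≤ k≤h)))
        where
        k<n′ : k < n′
        k<n′ = ≤-<-trans k≤h (0<n⇒⌊n/2⌋<n (≤-trans (s≤s z≤n) 4≤n′))
        k+m≡n′ : k + (n′ ∸ k) ≡ n′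
        k+m≡n′ = m+[n∸m]≡n (<⇒≤ k<n′)

    V-n≡cost : V (suc n′) ≡ cost r P′
    V-n≡cost = V≡cost (cong suc r+P′≡n′) 0<P′ recurrence-n

    growing-strictly-n : ∀ {r′} → r ≡ suc r′ → GrowingStrictly (suc n′)
    growing-strictly-n {r′} refl = begin
      V (suc n′) + p * q                 ≤⟨ +-monoʳ-≤ (V (suc n′)) (*-monoʳ-≤ p (m≤m*n q (q ^ r′) {{m^n≢0 q r′}})) ⟩
      V (suc n′) + p * (q * q ^ r′)      ≡⟨ cong (_+ p * q ^ suc r′) V-n≡cost ⟩
      cost (suc r′) P′ + p * q ^ suc r′  ≤⟨ cost-r+pq^r≤cost-0 refl ⟩
      cost 0 n′                          ≡⟨ cost-zero refl n′ ⟩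
      q * q * V n′ + 1                   ∎

    invariant : Invariant (suc n′)
    invariant = by-cases r refl
      where
      recurrence-at-kstar : 4 ≤ suc n′ → F (suc n′) ≡ u F (suc n′) q (kstar (suc n′))
      recurrence-at-kstar _ = subst (λ k → F (suc n′) ≡ u F (suc n′) q k) (sym kstar-n) recurrence-n
      by-cases : ∀ x → r ≡ x → Invariant (suc n′)
      by-cases zero refl = record
        { recurrence       = recurrence-at-kstar
        ; growing          = ≤-reflexive (trans V-n≡cost (trans (cong (cost 0) P′≡n′) (cost-zero refl n′)))
        ; growing-strictly = λ 0<kstar → contradiction (subst (0 <_) kstar-n 0<kstar) (<-irrefl refl)
        }
        where
        P′≡n′ : P′ ≡ n′
        P′≡n′ = trans (sym (+-identityʳ P′)) P′+r≡n′
      by-cases (suc _) r≡ = record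
        { recurrence       = recurrence-at-kstar
        ; growing          = ≤-trans (m≤m+n _ _) (growing-strictly-n r≡)
        ; growing-strictly = λ _ → growing-strictly-n r≡
        }

  invariant : ∀ n → Invariant n
  invariant = <-rec Invariant step
    where
    step : ∀ n → (∀ {i} → i < n → Invariant i) → Invariant n
    step 0 _ = invariant-0
    step 1 _ = invariant-1
    step 2 _ = invariant-2
    step 3 _ = invariant-3
    step 4 _ = invariant-4
    step n@(suc n′@(suc (suc (suc (suc _))))) ih with binary-decomposition n z<s
    ... | s , r , r<2^s , 2^s+r≡n =
      Step.invariant {n′} (s≤s (s≤s (s≤s (s≤s z≤n)))) (λ i≤n′ → ih (s≤s i≤n′)) {s} {r} r<2^s 2^s+r≡n

  fopt≡u-at-kstar : ∀ n → 4 ≤ n → F n ≡ u F n q (kstar n)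
  fopt≡u-at-kstar n = recurrence (invariant n)

proposition3p37 : ∀ (N : ℕ) → 5 ≤ N → ∃[ q₀ ] (∀ (q : ℕ) → IsPrimePower q → q₀ ≤ q →
                    fopt N q ≡ u (λ m → fopt m q) N q (kstar N))
proposition3p37 N 5≤N = 2 , λ { (suc (suc a)) _ (s≤s (s≤s _)) →
  Optimality.fopt≡u-at-kstar a N (≤-trans (n≤1+n 4) 5≤N) }
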